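{- Let $G_1$ and $G_2$ be graphs with nonempty, disjoint vertex sets, let $S_1$ and $S_2$ be Grundy total dominating sequences of $G_1$ and $G_2$, respectively, and let $G=G_1\vee G_2$. Then: 1. If $\eta(G_1)=\eta(G_2)=0$ and $|\widehat S_1|\ge|\widehat S_2|$, then $S_1$ is a Grundy total dominating sequence of $G$. 2. If $\eta(G_1)=\eta(G_2)=1$, $|\widehat S_1|\ge|\widehat S_2|$ and $v$ is an isolated vertex of $G_1$, then $(v)\oplus S_1\oplus(w)$ is a Grundy total dominating sequence of $G$ for any $w\in V(G_2)$. 3. If $\eta(G_1)=1$ and $\eta(G_2)=0$: if $|\widehat S_1|+2\ge|\widehat S_2|$, then $(v)\oplus S_1\oplus(w)$ is a Grundy total dominating sequence of $G$ for any isolated vertex $v$ of $G_1$ and any $w\in V(G_2)$; and if $|\widehat S_1|+2\le|\widehat S_2|-1$, then $S_2$ is a Grundy total dominating sequence of $G$. Hence $\gamma_{\rm gr}^t(G)=\max\{\gamma_{\rm gr}^t(G_1)+2\eta(G_1),\ \gamma_{\rm gr}^t(G_2)+2\eta(G_2)\}$.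
   Context: All graphs are finite and simple; $N(x)$ is the open neighborhood of $x$. A sequence $(v_1,\ldots,v_k)$ of distinct vertices is legal if for every $i\in\{1,\ldots,k\}$, $N(v_i)\setminus\bigcup_{j=1}^{i-1}N(v_j)\neq\emptyset$ (the empty sequence is legal; in particular an isolated vertex never belongs to a legal sequence). $\gamma_{\rm gr}^t(G)$ is the maximum length of a legal sequence (defined also for graphs with isolated vertices; $0$ for graphs without edges), and a legal sequence of that length is a Grundy total dominating sequence. $\widehat S$ denotes the vertex set of a sequence $S$. $\eta(G)=1$ if $G$ has an isolated vertex and $\eta(G)=0$ otherwise. $G_1\vee G_2$ is the join: the disjoint union of $G_1$ and $G_2$ together with all edges between $V(G_1)$ and $V(G_2)$. For sequences with disjoint vertex sets, $(a_1,\ldots,a_n)\oplus(b_1,\ldots,b_m)=(a_1,\ldots,a_n,b_1,\ldots,b_m)$. -}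

module Defs where

open import Data.Nat using (ℕ; zero; suc; _+_; _*_; _≤_; _<_; _⊔_)
open import Data.Fin using (Fin; toℕ; splitAt)
open import Data.Bool using (Bool; true; false; not; if_then_else_)
open import Data.List using (List; length; lookup; allFin)
open import Data.Bool.ListAction using (any; all)
open import Data.List.Relation.Unary.Unique.Propositional using (Unique)
open import Data.Sum using (_⊎_; inj₁; inj₂)
open import Data.Product using (Σ; ∃; ∃-syntax; _×_; _,_)
open import Relation.Binary.PropositionalEquality using (_≡_; refl)
open import Relation.Nullary using (¬_)
import Data.List as L

record Graph (n : ℕ) : Set where
  field
    adj    : Fin n → Fin n → Bool
    sym    : ∀ x y → adj x y ≡ adj y x
    irrefl : ∀ x → adj x x ≡ false

open Graph public

Adj : ∀ {n} → Graph n → Fin n → Fin n → Set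
Adj G x y = adj G x y ≡ true

Legal : ∀ {n} → Graph n → List (Fin n) → Set
Legal G S =
  Unique S ×
  ((i : Fin (length S)) →
     ∃[ u ] (Adj G (lookup S i) u ×
             ((j : Fin (length S)) → toℕ j < toℕ i → ¬ Adj G (lookup S j) u)))

GrundyTDS : ∀ {n} → Graph n → List (Fin n) → Set
GrundyTDS G S = Legal G S × (∀ T → Legal G T → length T ≤ length S)

IsGrundyTotalNumber : ∀ {n} → Graph n → ℕ → Set
IsGrundyTotalNumber G k =
  (∃[ S ] (Legal G S × length S ≡ k)) × (∀ T → Legal G T → length T ≤ k)

Isolated : ∀ {n} → Graph n → Fin n → Set
Isolated G v = ∀ u → ¬ Adj G v u

η : ∀ {n} → Graph n → ℕ
η {n} G =
  if any (λ v → all (λ u → not (adj G v u)) (allFin n)) (allFin n) then 1 else 0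

-- The join G₁ ∨ G₂ on vertex set Fin (n₁ + n₂): vertices of G₁ are
-- v ↑ˡ n₂, vertices of G₂ are n₁ ↑ʳ w.
joinAdj : ∀ {n₁ n₂} → Graph n₁ → Graph n₂ → Fin n₁ ⊎ Fin n₂ → Fin n₁ ⊎ Fin n₂ → Bool
joinAdj G₁ G₂ (inj₁ a) (inj₁ b) = adj G₁ a b
joinAdj G₁ G₂ (inj₁ a) (inj₂ b) = true
joinAdj G₁ G₂ (inj₂ a) (inj₁ b) = true
joinAdj G₁ G₂ (inj₂ a) (inj₂ b) = adj G₂ a b

joinAdj-sym : ∀ {n₁ n₂} (G₁ : Graph n₁) (G₂ : Graph n₂) p q →
  joinAdj G₁ G₂ p q ≡ joinAdj G₁ G₂ q p
joinAdj-sym G₁ G₂ (inj₁ a) (inj₁ b) = sym G₁ a b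
joinAdj-sym G₁ G₂ (inj₁ a) (inj₂ b) = refl
joinAdj-sym G₁ G₂ (inj₂ a) (inj₁ b) = refl
joinAdj-sym G₁ G₂ (inj₂ a) (inj₂ b) = sym G₂ a b

joinAdj-irr : ∀ {n₁ n₂} (G₁ : Graph n₁) (G₂ : Graph n₂) p → joinAdj G₁ G₂ p p ≡ false
joinAdj-irr G₁ G₂ (inj₁ a) = irrefl G₁ a
joinAdj-irr G₁ G₂ (inj₂ a) = irrefl G₂ a

_∨G_ : ∀ {n₁ n₂} → Graph n₁ → Graph n₂ → Graph (n₁ + n₂)
_∨G_ {n₁} G₁ G₂ = record
  { adj    = λ x y → joinAdj G₁ G₂ (splitAt n₁ x) (splitAt n₁ y)
  ; sym    = λ x y → joinAdj-sym G₁ G₂ (splitAt n₁ x) (splitAt n₁ y)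
  ; irrefl = λ x → joinAdj-irr G₁ G₂ (splitAt n₁ x)
  }

-- After the first vertex of a legal sequence of G₁ ∨ G₂, say a vertex of G₁, all of V(G₂) is
-- dominated; so the sequence continues with vertices of G₁ only, except for possibly one last
-- vertex of G₂, which has to footprint a vertex of G₁ not yet dominated.  The G₁-part
-- following the first vertex is legal in G₁.  If G₁ has an isolated vertex this bounds the length
-- by γ_gr^t(G₁) + 2, and the bound is attained by (v) ⊕ S₁ ⊕ (w).  Otherwise the first vertex has
-- a neighbour in G₁ and can be kept, and the last G₂-vertex can be replaced by a G₁-neighbour of
-- the vertex it footprints, giving a legal sequence of G₁ of the same length.

module Submission where

open import Defs
open import Data.Bool using (Bool; true; false; not; T)
open import Data.Bool.ListAction using (any; all)
open import Data.Bool.Properties using (_≟_; T-≡; T-not-≡; ¬-not)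
open import Data.Empty using (⊥-elim)
open import Data.Fin as F using (Fin; _↑ˡ_; _↑ʳ_; splitAt; join; toℕ)
open import Data.Fin.Properties using (splitAt-join; any?)
open import Data.List using (List; []; _∷_; length; map; [_]; _++_; lookup; allFin)
open import Data.List.Properties using (length-map; map-++; map-∘)
open import Data.List.Membership.Propositional using (_∉_)
open import Data.List.Membership.Propositional.Properties using (∈-allFin)
open import Data.List.Relation.Unary.All as All using ()
open import Data.List.Relation.Unary.All.Properties using (all⁺; all⁻; ¬Any⇒All¬)
open import Data.List.Relation.Unary.Any as Any using (here; there; satisfied)
open import Data.List.Relation.Unary.Any.Properties using (any⁺; any⁻)
open import Data.List.Relation.Unary.AllPairs using ([]; _∷_)
open import Data.List.Relation.Unary.Unique.Propositional using (Unique)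
open import Data.Nat using (ℕ; suc; _+_; _*_; _∸_; _≤_; _<_; _⊔_; z≤n; s≤s)
open import Data.Nat.Properties
  using (≤-refl; ≤-reflexive; ≤-trans; ≤-total; m≤n⇒m≤1+n; +-comm; +-identityʳ; +-monoʳ-≤; +-monoˡ-≤;
         m∸n≤m; ⊔-lub; m≤m⊔n; m≤n⊔m; m≥n⇒m⊔n≡m; m≤n⇒m⊔n≡n; module ≤-Reasoning)
open import Data.Product as Prod using (_×_; _,_; ∃-syntax)
open import Data.Sum as Sum using (_⊎_; inj₁; inj₂; [_,_]′; swap)
open import Data.Unit using (⊤; tt)
open import Function using (_∘_)
open import Function.Bundles using (Equivalence)
open import Level using (0ℓ)
open import Relation.Nullary using (¬_; yes; no)
open import Relation.Unary using (Pred; ∅; _∪_; _⊆_)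
open import Relation.Binary.PropositionalEquality
  using (_≡_; refl; trans; cong; subst; module ≡-Reasoning) renaming (sym to ≡-sym)

module Domination {V : Set} (A : V → V → Bool) where

  N : V → Pred V 0ℓ
  N x u = A x u ≡ true

  Footprints : Pred V 0ℓ → V → Set
  Footprints D x = ∃[ u ] (N x u × ¬ D u)

  -- D is the set of vertices dominated before the sequence starts.
  LegalFrom : Pred V 0ℓ → List V → Set
  LegalFrom D []      = ⊤
  LegalFrom D (x ∷ S) = Footprints D x × LegalFrom (D ∪ N x) S

  Dominated : Pred V 0ℓ → List V → Pred V 0ℓ
  Dominated D []      = D
  Dominated D (x ∷ S) = Dominated (D ∪ N x) S

  legalFrom-++ : ∀ {D} S {R} → LegalFrom D S → LegalFrom (Dominated D S) R → LegalFrom D (S ++ R)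
  legalFrom-++ []      _              legal-R = legal-R
  legalFrom-++ (x ∷ S) (fp , legal-S) legal-R = fp , legalFrom-++ S legal-S legal-R

  legalFrom-∷ʳ : ∀ {D} S {x u} → LegalFrom D S → N x u → ¬ Dominated D S u → LegalFrom D (S ++ [ x ])
  legalFrom-∷ʳ S legal-S xu u∉ = legalFrom-++ S legal-S ((_ , xu , u∉) , tt)

  legalFrom-antimono : ∀ {D D′} → D′ ⊆ D → ∀ S → LegalFrom D S → LegalFrom D′ S
  legalFrom-antimono D′⊆D []      _                          = tt
  legalFrom-antimono D′⊆D (x ∷ S) ((u , xu , u∉D) , legal) =
    (u , xu , u∉D ∘ D′⊆D) , legalFrom-antimono (Sum.map₁ D′⊆D) S legal

  ∉-legalFrom : ∀ {D x} S → N x ⊆ D → LegalFrom D S → x ∉ S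
  ∉-legalFrom (y ∷ S) Nx⊆D ((u , yu , u∉D) , _) (here refl) = u∉D (Nx⊆D yu)
  ∉-legalFrom (y ∷ S) Nx⊆D (_ , legal)         (there x∈S) = ∉-legalFrom S (inj₁ ∘ Nx⊆D) legal x∈S

  legalFrom⇒unique : ∀ {D} S → LegalFrom D S → Unique S
  legalFrom⇒unique []      _           = []
  legalFrom⇒unique (x ∷ S) (_ , legal) = ¬Any⇒All¬ S (∉-legalFrom S inj₂ legal) ∷ legalFrom⇒unique S legal

  -- The footprint condition of Defs.Legal, read relative to D.
  IndexedLegalFrom : Pred V 0ℓ → List V → Set
  IndexedLegalFrom D S =
    (i : Fin (length S)) → ∃[ u ] (N (lookup S i) u × ¬ D u ×
      ((j : Fin (length S)) → toℕ j < toℕ i → ¬ N (lookup S j) u))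

  indexed⇒legalFrom : ∀ {D} S → IndexedLegalFrom D S → LegalFrom D S
  indexed⇒legalFrom []      _  = tt
  indexed⇒legalFrom (x ∷ S) fp =
    (let u , xu , u∉D , _ = fp F.zero in u , xu , u∉D) ,
    indexed⇒legalFrom S λ i →
      let u , yu , u∉D , earlier = fp (F.suc i)
      in u , yu , [ u∉D , earlier F.zero (s≤s z≤n) ]′ , λ j j<i → earlier (F.suc j) (s≤s j<i)

  legalFrom⇒indexed : ∀ {D} S → LegalFrom D S → IndexedLegalFrom D S
  legalFrom⇒indexed (x ∷ S) ((u , xu , u∉D) , _) F.zero = u , xu , u∉D , λ _ ()
  legalFrom⇒indexed (x ∷ S) (_ , legal) (F.suc i) =
    let u , yu , u∉D , earlier = legalFrom⇒indexed S legal i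
    in u , yu , u∉D ∘ inj₁ , λ { F.zero _ → u∉D ∘ inj₂ ; (F.suc j) (s≤s j<i) → earlier j j<i }

module _ {n} (G : Graph n) where
  open Domination (adj G)

  legal⇒legalFrom : ∀ S → Legal G S → LegalFrom ∅ S
  legal⇒legalFrom S (_ , fp) = indexed⇒legalFrom S λ i → let u , xu , earlier = fp i in u , xu , (λ ()) , earlier

  legalFrom⇒legal : ∀ S → LegalFrom ∅ S → Legal G S
  legalFrom⇒legal S legal =
    legalFrom⇒unique S legal , λ i → let u , xu , _ , earlier = legalFrom⇒indexed S legal i in u , xu , earlier

  isolated-∉-dominated : ∀ {v D} → Isolated G v → ¬ D v → ∀ S → ¬ Dominated D S v
  isolated-∉-dominated iso v∉D []      = v∉D
  isolated-∉-dominated {v} iso v∉D (x ∷ S) =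
    isolated-∉-dominated iso [ v∉D , (λ xv → iso x (trans (sym G v x) xv)) ]′ S

module _ {V W : Set} {A : V → V → Bool} {B : W → W → Bool}
         (f : V → W) (f-adj : ∀ x y → B (f x) (f y) ≡ A x y) where
  private
    module DA = Domination A
    module DB = Domination B

    ∪N-pullback : ∀ {D : Pred V 0ℓ} {D′ : Pred W 0ℓ} {x} →
                  D′ ∘ f ⊆ D → (D′ ∪ DB.N (f x)) ∘ f ⊆ D ∪ DA.N x
    ∪N-pullback D′f⊆D = Sum.map D′f⊆D (trans (≡-sym (f-adj _ _)))

  legalFrom-map : ∀ {D : Pred V 0ℓ} {D′ : Pred W 0ℓ} →
                  D′ ∘ f ⊆ D → ∀ S → DA.LegalFrom D S → DB.LegalFrom D′ (map f S)
  legalFrom-map D′f⊆D []      _                          = tt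
  legalFrom-map {D} {D′} D′f⊆D (x ∷ S) ((u , xu , u∉D) , legal) =
    (f u , trans (f-adj x u) xu , u∉D ∘ D′f⊆D) ,
    legalFrom-map {D ∪ DA.N x} {D′ ∪ DB.N (f x)} (∪N-pullback {D} {D′} {x} D′f⊆D) S legal

  dominated-map : ∀ {D : Pred V 0ℓ} {D′ : Pred W 0ℓ} →
                  D′ ∘ f ⊆ D → ∀ S → DB.Dominated D′ (map f S) ∘ f ⊆ DA.Dominated D S
  dominated-map D′f⊆D []      = D′f⊆D
  dominated-map {D} {D′} D′f⊆D (x ∷ S) =
    dominated-map {D ∪ DA.N x} {D′ ∪ DB.N (f x)} (∪N-pullback {D} {D′} {x} D′f⊆D) S

isolated? : ∀ {n} → Graph n → Fin n → Bool
isolated? {n} G v = all (λ u → not (adj G v u)) (allFin n)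

isolated?-sound : ∀ {n} (G : Graph n) {v} → T (isolated? G v) → Isolated G v
isolated?-sound G t u vu = subst (T ∘ not) vu (All.lookup (all⁺ _ _ t) (∈-allFin u))

isolated?-complete : ∀ {n} (G : Graph n) {v} → Isolated G v → T (isolated? G v)
isolated?-complete {n} G {v} iso =
  all⁻ (λ u → not (adj G v u)) {xs = allFin n} (All.tabulate λ {u} _ → Equivalence.from T-not-≡ (¬-not (iso u)))

η-cases : ∀ {n} (G : Graph n) →
          (η G ≡ 0 × (∀ v → ∃[ u ] Adj G v u)) ⊎ (η G ≡ 1 × ∃[ v ] Isolated G v)
η-cases {n} G with any (isolated? G) (allFin n) in eq
... | true  =
  inj₂ (refl , Prod.map₂ (isolated?-sound G) (satisfied (any⁻ (isolated? G) (allFin n) (Equivalence.from T-≡ eq))))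
... | false = inj₁ (refl , has-neighbour)
  where
  has-neighbour : ∀ v → ∃[ u ] Adj G v u
  has-neighbour v with any? (λ u → adj G v u ≟ true)
  ... | yes neighbour = neighbour
  ... | no  isolated  = ⊥-elim (subst T eq (any⁺ (isolated? G)
    (Any.map (λ { refl → isolated?-complete G (λ u vu → isolated (u , vu)) }) (∈-allFin v))))

length-framed : ∀ {A : Set} (x : A) S y → length (x ∷ S ++ [ y ]) ≡ 2 + length S
length-framed x []      y = refl
length-framed x (z ∷ S) y = cong suc (length-framed x S y)

module _ {n₁ n₂} (G₁ : Graph n₁) (G₂ : Graph n₂) where
  private
    module J  = Domination (joinAdj G₁ G₂)
    module D₁ = Domination (adj G₁)

  legalFrom-inj₁ : ∀ S → D₁.LegalFrom ∅ S → J.LegalFrom ∅ (map inj₁ S)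
  legalFrom-inj₁ = legalFrom-map inj₁ (λ _ _ → refl) (λ ())

  legalFrom-inj₂ : ∀ S → Domination.LegalFrom (adj G₂) ∅ S → J.LegalFrom ∅ (map inj₂ S)
  legalFrom-inj₂ = legalFrom-map inj₂ (λ _ _ → refl) (λ ())

  legalFrom-framed : ∀ {v} → Isolated G₁ v → ∀ S → D₁.LegalFrom ∅ S → ∀ w →
                     J.LegalFrom ∅ (inj₁ v ∷ map inj₁ S ++ [ inj₂ w ])
  legalFrom-framed {v} iso S legal w =
    (inj₂ w , refl , λ ()) ,
    J.legalFrom-∷ʳ (map inj₁ S) (legalFrom-map inj₁ (λ _ _ → refl) v-isolated S legal) refl
      (isolated-∉-dominated G₁ iso (λ ()) S ∘ dominated-map inj₁ (λ _ _ → refl) v-isolated S)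
    where
    v-isolated : (∅ ∪ J.N (inj₁ v)) ∘ inj₁ ⊆ ∅
    v-isolated (inj₂ vu) = iso _ vu

  -- Once V(G₂) is dominated, a G₂-vertex of a legal sequence dominates all of V(G₁) and so has to
  -- come last.
  legalTail : ∀ {D D′} → (∀ b → D′ (inj₂ b)) → D ⊆ D′ ∘ inj₁ → ∀ T → J.LegalFrom D′ T →
              ∃[ A ] (D₁.LegalFrom D A ×
                      (length T ≡ length A ⊎ (length T ≡ suc (length A) × ∃[ u ] ¬ D₁.Dominated D A u)))
  legalTail all₂ D⊆ []           _                          = [] , tt , inj₁ refl
  legalTail all₂ D⊆ (inj₁ x ∷ T) ((inj₂ b , _ , b∉) , _)    = ⊥-elim (b∉ (all₂ b))
  legalTail {D} {D′} all₂ D⊆ (inj₁ x ∷ T) ((inj₁ u , xu , u∉) , legal)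
    with legalTail {D ∪ D₁.N x} {D′ ∪ J.N (inj₁ x)} (inj₁ ∘ all₂) (Sum.map₁ D⊆) T legal
  ... | A , legal-A , shape =
    x ∷ A , ((u , xu , u∉ ∘ D⊆) , legal-A) , Sum.map (cong suc) (Prod.map₁ (cong suc)) shape
  legalTail all₂ D⊆ (inj₂ y ∷ T)     ((inj₂ b , _ , b∉) , _)     = ⊥-elim (b∉ (all₂ b))
  legalTail all₂ D⊆ (inj₂ y ∷ [])    ((inj₁ u , _ , u∉) , _)     = [] , tt , inj₂ (refl , u , u∉ ∘ D⊆)
  legalTail all₂ D⊆ (inj₂ y ∷ z ∷ T) (_ , (inj₁ q , _ , q∉) , _) = ⊥-elim (q∉ (inj₂ refl))
  legalTail all₂ D⊆ (inj₂ y ∷ z ∷ T) (_ , (inj₂ q , _ , q∉) , _) = ⊥-elim (q∉ (inj₁ (all₂ q)))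

  private
    tailAfter : ∀ a T → J.LegalFrom (∅ ∪ J.N (inj₁ a)) T →
                ∃[ A ] (D₁.LegalFrom (∅ ∪ D₁.N a) A ×
                        (length T ≡ length A ⊎ (length T ≡ suc (length A) × ∃[ u ] ¬ D₁.Dominated ∅ (a ∷ A) u)))
    tailAfter a = legalTail (λ _ → inj₂ refl) (λ d → d)

  length-inj₁∷≤+2 : ∀ {k} → (∀ S → D₁.LegalFrom ∅ S → length S ≤ k) →
                    ∀ a T → J.LegalFrom ∅ (inj₁ a ∷ T) → length (inj₁ a ∷ T) ≤ k + 2
  length-inj₁∷≤+2 {k} bound a T (_ , legal) with tailAfter a T legal
  ... | A , legal-A , shape = begin
    suc (length T)   ≤⟨ s≤s ([ m≤n⇒m≤1+n ∘ ≤-reflexive , ≤-reflexive ∘ Prod.proj₁ ]′ shape) ⟩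
    2 + length A     ≤⟨ +-monoʳ-≤ 2 (bound A (D₁.legalFrom-antimono (λ ()) A legal-A)) ⟩
    2 + k            ≡⟨ +-comm 2 k ⟩
    k + 2            ∎
    where open ≤-Reasoning

  length-inj₁∷≤ : ∀ {k} → (∀ v → ∃[ u ] Adj G₁ v u) → (∀ S → D₁.LegalFrom ∅ S → length S ≤ k) →
                  ∀ a T → J.LegalFrom ∅ (inj₁ a ∷ T) → length (inj₁ a ∷ T) ≤ k
  length-inj₁∷≤ {k} neighbour bound a T (_ , legal) with tailAfter a T legal
  ... | A , legal-A , inj₁ |T|≡|A| =
    subst (_≤ k) (cong suc (≡-sym |T|≡|A|)) (bound (a ∷ A) (a-footprints , legal-A))
    where a-footprints = Prod.map₂ (_, λ ()) (neighbour a)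
  ... | A , legal-A , inj₂ (|T|≡1+|A| , u , u∉) =
    let x , ux = neighbour u
    in subst (_≤ k) (trans (length-framed a A x) (cong suc (≡-sym |T|≡1+|A|)))
         (bound (a ∷ A ++ [ x ]) (D₁.legalFrom-∷ʳ (a ∷ A) (a-footprints , legal-A) (trans (sym G₁ x u) ux) u∉))
    where a-footprints = Prod.map₂ (_, λ ()) (neighbour a)

  length-inj₁∷≤η : ∀ {k} → (∀ S → D₁.LegalFrom ∅ S → length S ≤ k) →
                   ∀ a T → J.LegalFrom ∅ (inj₁ a ∷ T) → length (inj₁ a ∷ T) ≤ k + 2 * η G₁
  length-inj₁∷≤η {k} bound a T legal with η-cases G₁
  ... | inj₁ (η≡0 , neighbour) rewrite η≡0 | +-identityʳ k = length-inj₁∷≤ neighbour bound a T legal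
  ... | inj₂ (η≡1 , _)         rewrite η≡1 = length-inj₁∷≤+2 bound a T legal

  legalFrom-join-length≡ : 0 < n₂ → ∀ S → D₁.LegalFrom ∅ S →
                          ∃[ T ] (J.LegalFrom ∅ T × length T ≡ length S + 2 * η G₁)
  legalFrom-join-length≡ (s≤s _) S legal with η-cases G₁
  ... | inj₁ (η≡0 , _) rewrite η≡0 =
    map inj₁ S , legalFrom-inj₁ S legal , trans (length-map inj₁ S) (≡-sym (+-identityʳ _))
  ... | inj₂ (η≡1 , v , iso) rewrite η≡1 =
    inj₁ v ∷ map inj₁ S ++ [ inj₂ F.zero ] , legalFrom-framed iso S legal F.zero ,
    trans (length-framed (inj₁ v) (map inj₁ S) _) (trans (cong (2 +_) (length-map inj₁ S)) (+-comm 2 _))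

  legalFrom-swap : ∀ T → J.LegalFrom ∅ T → Domination.LegalFrom (joinAdj G₂ G₁) ∅ (map swap T)
  legalFrom-swap = legalFrom-map swap swap-adj (λ ())
    where
    swap-adj : ∀ x y → joinAdj G₂ G₁ (swap x) (swap y) ≡ joinAdj G₁ G₂ x y
    swap-adj (inj₁ _) (inj₁ _) = refl
    swap-adj (inj₁ _) (inj₂ _) = refl
    swap-adj (inj₂ _) (inj₁ _) = refl
    swap-adj (inj₂ _) (inj₂ _) = refl

joinGrundyNumber : ∀ {n₁ n₂} → Graph n₁ → Graph n₂ → ℕ → ℕ → ℕ
joinGrundyNumber G₁ G₂ k₁ k₂ = (k₁ + 2 * η G₁) ⊔ (k₂ + 2 * η G₂)

module _ {n₁ n₂} (G₁ : Graph n₁) (G₂ : Graph n₂) where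
  private
    module J = Domination (joinAdj G₁ G₂)

  legal-map-join : ∀ T → J.LegalFrom ∅ T → Legal (G₁ ∨G G₂) (map (join n₁ n₂) T)
  legal-map-join T legal = legalFrom⇒legal (G₁ ∨G G₂) _ (legalFrom-map (join n₁ n₂) join-adj (λ ()) T legal)
    where
    join-adj : ∀ x y → adj (G₁ ∨G G₂) (join n₁ n₂ x) (join n₁ n₂ y) ≡ joinAdj G₁ G₂ x y
    join-adj x y rewrite splitAt-join n₁ n₂ x | splitAt-join n₁ n₂ y = refl

  legalFrom-map-splitAt : ∀ T → Legal (G₁ ∨G G₂) T → J.LegalFrom ∅ (map (splitAt n₁) T)
  legalFrom-map-splitAt T legal =
    legalFrom-map (splitAt n₁) (λ _ _ → refl) (λ ()) T (legal⇒legalFrom (G₁ ∨G G₂) T legal)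

  length-legalFrom-join≤ : ∀ {k₁ k₂} →
    (∀ S → Domination.LegalFrom (adj G₁) ∅ S → length S ≤ k₁) →
    (∀ S → Domination.LegalFrom (adj G₂) ∅ S → length S ≤ k₂) →
    ∀ T → J.LegalFrom ∅ T → length T ≤ joinGrundyNumber G₁ G₂ k₁ k₂
  length-legalFrom-join≤ bound₁ bound₂ []           _     = z≤n
  length-legalFrom-join≤ bound₁ bound₂ (inj₁ a ∷ T) legal =
    ≤-trans (length-inj₁∷≤η G₁ G₂ bound₁ a T legal) (m≤m⊔n _ _)
  length-legalFrom-join≤ {k₁} {k₂} bound₁ bound₂ (inj₂ b ∷ T) legal = ≤-trans
    (subst (_≤ k₂ + 2 * η G₂) (cong suc (length-map swap T))
      (length-inj₁∷≤η G₂ G₁ bound₂ b (map swap T) (legalFrom-swap G₁ G₂ (inj₂ b ∷ T) legal)))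
    (m≤n⊔m (k₁ + 2 * η G₁) _)

  legal-join-length≤ : ∀ {k₁ k₂} → (∀ S → Legal G₁ S → length S ≤ k₁) → (∀ S → Legal G₂ S → length S ≤ k₂) →
                       ∀ T → Legal (G₁ ∨G G₂) T → length T ≤ joinGrundyNumber G₁ G₂ k₁ k₂
  legal-join-length≤ bound₁ bound₂ T legal =
    subst (_≤ _) (length-map (splitAt n₁) T)
      (length-legalFrom-join≤ (λ S → bound₁ S ∘ legalFrom⇒legal G₁ S) (λ S → bound₂ S ∘ legalFrom⇒legal G₂ S)
        (map (splitAt n₁) T) (legalFrom-map-splitAt T legal))

  legal-join-length≡ : 0 < n₁ → 0 < n₂ → ∀ {S₁ S₂} → Legal G₁ S₁ → Legal G₂ S₂ →
    ∃[ T ] (Legal (G₁ ∨G G₂) T × length T ≡ joinGrundyNumber G₁ G₂ (length S₁) (length S₂))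
  legal-join-length≡ 0<n₁ 0<n₂ {S₁} {S₂} legal₁ legal₂
    with ≤-total (length S₂ + 2 * η G₂) (length S₁ + 2 * η G₁)
  ... | inj₁ right≤left =
    let T , legal , |T|≡ = legalFrom-join-length≡ G₁ G₂ 0<n₂ S₁ (legal⇒legalFrom G₁ S₁ legal₁)
    in map (join n₁ n₂) T , legal-map-join T legal ,
       trans (length-map _ T) (trans |T|≡ (≡-sym (m≥n⇒m⊔n≡m right≤left)))
  ... | inj₂ left≤right =
    let T , legal , |T|≡ = legalFrom-join-length≡ G₂ G₁ 0<n₁ S₂ (legal⇒legalFrom G₂ S₂ legal₂)
    in map (join n₁ n₂) (map swap T) , legal-map-join (map swap T) (legalFrom-swap G₂ G₁ T legal) ,
       trans (length-map _ (map swap T)) (trans (length-map swap T) (trans |T|≡ (≡-sym (m≤n⇒m⊔n≡n left≤right))))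

isGrundyTotalNumber-join : ∀ {n₁ n₂} {G₁ : Graph n₁} {G₂ : Graph n₂} {k₁ k₂} → 0 < n₁ → 0 < n₂ →
  IsGrundyTotalNumber G₁ k₁ → IsGrundyTotalNumber G₂ k₂ →
  IsGrundyTotalNumber (G₁ ∨G G₂) (joinGrundyNumber G₁ G₂ k₁ k₂)
isGrundyTotalNumber-join {G₁ = G₁} {G₂} 0<n₁ 0<n₂ ((_ , legal₁ , refl) , bound₁) ((_ , legal₂ , refl) , bound₂) =
  legal-join-length≡ G₁ G₂ 0<n₁ 0<n₂ legal₁ legal₂ , legal-join-length≤ G₁ G₂ bound₁ bound₂

module _ {n₁ n₂} {G₁ : Graph n₁} {G₂ : Graph n₂} {S₁ S₂}
         (grundy₁ : GrundyTDS G₁ S₁) (grundy₂ : GrundyTDS G₂ S₂) where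
  private
    M : ℕ
    M = joinGrundyNumber G₁ G₂ (length S₁) (length S₂)

    grundyTDS-attaining : ∀ {S} → Legal (G₁ ∨G G₂) S → M ≤ length S → GrundyTDS (G₁ ∨G G₂) S
    grundyTDS-attaining legal M≤|S| = legal , λ T legal-T →
      ≤-trans (legal-join-length≤ G₁ G₂ (Prod.proj₂ grundy₁) (Prod.proj₂ grundy₂) T legal-T) M≤|S|

    map-join-inj₁ : ∀ (S : List (Fin n₁)) → map (join n₁ n₂) (map inj₁ S) ≡ map (_↑ˡ n₂) S
    map-join-inj₁ S = ≡-sym (map-∘ {g = join n₁ n₂} {f = inj₁} S)

  grundyTDS-↑ˡ : M ≤ length S₁ → GrundyTDS (G₁ ∨G G₂) (map (_↑ˡ n₂) S₁)
  grundyTDS-↑ˡ M≤ = grundyTDS-attaining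
    (subst (Legal (G₁ ∨G G₂)) (map-join-inj₁ S₁)
      (legal-map-join G₁ G₂ _ (legalFrom-inj₁ G₁ G₂ S₁ (legal⇒legalFrom G₁ S₁ (Prod.proj₁ grundy₁)))))
    (subst (M ≤_) (≡-sym (length-map _ S₁)) M≤)

  grundyTDS-↑ʳ : M ≤ length S₂ → GrundyTDS (G₁ ∨G G₂) (map (n₁ ↑ʳ_) S₂)
  grundyTDS-↑ʳ M≤ = grundyTDS-attaining
    (subst (Legal (G₁ ∨G G₂)) (≡-sym (map-∘ {g = join n₁ n₂} {f = inj₂} S₂))
      (legal-map-join G₁ G₂ _ (legalFrom-inj₂ G₁ G₂ S₂ (legal⇒legalFrom G₂ S₂ (Prod.proj₁ grundy₂)))))
    (subst (M ≤_) (≡-sym (length-map _ S₂)) M≤)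

  grundyTDS-framed : M ≤ length S₁ + 2 → ∀ {v} → Isolated G₁ v → ∀ w →
                     GrundyTDS (G₁ ∨G G₂) ([ v ↑ˡ n₂ ] ++ map (_↑ˡ n₂) S₁ ++ [ n₁ ↑ʳ w ])
  grundyTDS-framed M≤ {v} iso w = grundyTDS-attaining
    (subst (Legal (G₁ ∨G G₂))
      (cong (v ↑ˡ n₂ ∷_) (trans (map-++ (join n₁ n₂) (map inj₁ S₁) _) (cong (_++ _) (map-join-inj₁ S₁))))
      (legal-map-join G₁ G₂ (inj₁ v ∷ map inj₁ S₁ ++ [ inj₂ w ])
        (legalFrom-framed G₁ G₂ iso S₁ (legal⇒legalFrom G₁ S₁ (Prod.proj₁ grundy₁)) w)))
    (subst (M ≤_) |framed|≡ M≤)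
    where
    |framed|≡ : length S₁ + 2 ≡ length ([ v ↑ˡ n₂ ] ++ map (_↑ˡ n₂) S₁ ++ [ n₁ ↑ʳ w ])
    |framed|≡ = begin
      length S₁ + 2                     ≡⟨ +-comm (length S₁) 2 ⟩
      2 + length S₁                     ≡⟨ cong (2 +_) (length-map _ S₁) ⟨
      2 + length (map (_↑ˡ n₂) S₁)      ≡⟨ length-framed (v ↑ˡ n₂) (map (_↑ˡ n₂) S₁) (n₁ ↑ʳ w) ⟨
      length ([ v ↑ˡ n₂ ] ++ map (_↑ˡ n₂) S₁ ++ [ n₁ ↑ʳ w ]) ∎
      where open ≡-Reasoning

proposition4p2 : ∀ {n₁ n₂} (G₁ : Graph n₁) (G₂ : Graph n₂) (S₁ : List (Fin n₁)) (S₂ : List (Fin n₂))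
    → 0 < n₁ → 0 < n₂
    → GrundyTDS G₁ S₁ → GrundyTDS G₂ S₂
    → ((η G₁ ≡ 0 → η G₂ ≡ 0 → length S₂ ≤ length S₁
          → GrundyTDS (G₁ ∨G G₂) (map (_↑ˡ n₂) S₁))
      × (η G₁ ≡ 1 → η G₂ ≡ 1 → length S₂ ≤ length S₁
          → (v : Fin n₁) → Isolated G₁ v → (w : Fin n₂)
          → GrundyTDS (G₁ ∨G G₂) ([ v ↑ˡ n₂ ] ++ map (_↑ˡ n₂) S₁ ++ [ n₁ ↑ʳ w ]))
      × (η G₁ ≡ 1 → η G₂ ≡ 0 → length S₂ ≤ length S₁ + 2
          → (v : Fin n₁) → Isolated G₁ v → (w : Fin n₂)
          → GrundyTDS (G₁ ∨G G₂) ([ v ↑ˡ n₂ ] ++ map (_↑ˡ n₂) S₁ ++ [ n₁ ↑ʳ w ]))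
      × (η G₁ ≡ 1 → η G₂ ≡ 0 → length S₁ + 2 ≤ length S₂ ∸ 1
          → GrundyTDS (G₁ ∨G G₂) (map (n₁ ↑ʳ_) S₂)))
      × ((k₁ k₂ : ℕ) → IsGrundyTotalNumber G₁ k₁ → IsGrundyTotalNumber G₂ k₂
          → IsGrundyTotalNumber (G₁ ∨G G₂) ((k₁ + 2 * η G₁) ⊔ (k₂ + 2 * η G₂)))
proposition4p2 G₁ G₂ S₁ S₂ 0<n₁ 0<n₂ grundy₁ grundy₂ =
  ( (λ η₁≡0 η₂≡0 S₂≤S₁ → grundyTDS-↑ˡ grundy₁ grundy₂ (bound₀₀ η₁≡0 η₂≡0 S₂≤S₁))
  , (λ η₁≡1 η₂≡1 S₂≤S₁ _ iso → grundyTDS-framed grundy₁ grundy₂ (bound₁₁ η₁≡1 η₂≡1 S₂≤S₁) iso)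
  , (λ η₁≡1 η₂≡0 S₂≤S₁+2 _ iso → grundyTDS-framed grundy₁ grundy₂ (bound₁₀ η₁≡1 η₂≡0 S₂≤S₁+2) iso)
  , (λ η₁≡1 η₂≡0 S₁+2<S₂ → grundyTDS-↑ʳ grundy₁ grundy₂ (bound₁₀′ η₁≡1 η₂≡0 S₁+2<S₂)) )
  , λ _ _ → isGrundyTotalNumber-join 0<n₁ 0<n₂
  where
  bound₀₀ : ∀ {a b x y} → x ≡ 0 → y ≡ 0 → b ≤ a → (a + 2 * x) ⊔ (b + 2 * y) ≤ a
  bound₀₀ {a} {b} refl refl b≤a rewrite +-identityʳ a | +-identityʳ b = ⊔-lub ≤-refl b≤a

  bound₁₁ : ∀ {a b x y} → x ≡ 1 → y ≡ 1 → b ≤ a → (a + 2 * x) ⊔ (b + 2 * y) ≤ a + 2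
  bound₁₁ refl refl b≤a = ⊔-lub ≤-refl (+-monoˡ-≤ 2 b≤a)

  bound₁₀ : ∀ {a b x y} → x ≡ 1 → y ≡ 0 → b ≤ a + 2 → (a + 2 * x) ⊔ (b + 2 * y) ≤ a + 2
  bound₁₀ {b = b} refl refl b≤a+2 rewrite +-identityʳ b = ⊔-lub ≤-refl b≤a+2

  bound₁₀′ : ∀ {a b x y} → x ≡ 1 → y ≡ 0 → a + 2 ≤ b ∸ 1 → (a + 2 * x) ⊔ (b + 2 * y) ≤ b
  bound₁₀′ {b = b} refl refl a+2≤b∸1 rewrite +-identityʳ b = ⊔-lub (≤-trans a+2≤b∸1 (m∸n≤m b 1)) ≤-refl
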